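{- Let $A=(a_{i,j})$ be an $r\times r$ indecomposable Cartan matrix of finite type. Then the only $\mathbb{Z}^{\max}_{\ge0}$-valued $\mathbf{Y}$-frieze pattern associated to $A$ is the trivial one, $k(i,m)=0$ for all $(i,m)\in[1,r]\times\mathbb{Z}$.
   Context: A Cartan matrix is a symmetrisable integer matrix with $a_{i,i}=2$, $a_{i,j}\le0$ for $i\neq j$, $a_{i,j}=0$ iff $a_{j,i}=0$; finite type means all principal minors are positive; indecomposable means no nonempty proper $I\subset[1,r]$ has $a_{i,j}=0$ for all $i\in I$, $j\notin I$. The tropical semi-ring $\mathbb{Z}^{\max}_{\ge0}$ is $\mathbb{Z}_{\ge0}$ with semi-ring multiplication the usual addition and semi-ring addition $\max$ (so its multiplicative identity is $0$). A $\mathbb{Z}^{\max}_{\ge0}$-valued $\mathbf{Y}$-frieze pattern associated to $A$ is a map $k:[1,r]\times\mathbb{Z}\to\mathbb{Z}_{\ge0}$ satisfying the $\mathbf{Y}$-frieze relation $k(i,m)k(i,m+1)=\prod_{j>i}(1+k(j,m))^{ -a_{j,i}}\prod_{j<i}(1+k(j,m+1))^{ -a_{j,i}}$ interpreted in this semi-ring, i.e. \[ k(i,m)+k(i,m+1)=\sum_{j=i+1}^r(-a_{j,i})\max(0,k(j,m))+\sum_{j=1}^{i-1}(-a_{j,i})\max(0,k(j,m+1)) \] for all $(i,m)$. -}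

module Defs where

open import Data.Nat using (ℕ; zero; suc)
open import Data.Integer using (ℤ; +_; -_; _*_; _+_; _≤_; _<_; _⊔_)
import Data.Nat as ℕ
open import Data.Fin using (Fin; zero; suc; punchIn; toℕ)
import Data.Fin as F
open import Data.Bool using (Bool; true; false)
open import Data.Product using (Σ; _×_; _,_; ∃)
open import Relation.Nullary using (¬_)
open import Relation.Binary.PropositionalEquality using (_≡_; _≢_)
open import Function.Bundles using (_⇔_)

Matrix : ℕ → Set
Matrix n = Fin n → Fin n → ℤ

∑ : (n : ℕ) → (Fin n → ℤ) → ℤ
∑ zero    f = + 0
∑ (suc n) f = f zero + ∑ n (λ i → f (suc i))

sgn : ℕ → ℤ
sgn zero          = + 1
sgn (suc zero)    = - (+ 1)
sgn (suc (suc n)) = sgn n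

det : (n : ℕ) → Matrix n → ℤ
det zero    M = + 1
det (suc n) M =
  ∑ (suc n) (λ j → sgn (toℕ j) * (M zero j * det n (λ a b → M (suc a) (punchIn j b))))

Symmetrisable : {r : ℕ} → Matrix r → Set
Symmetrisable {r} A =
  Σ (Fin r → ℕ) λ d → ((i : Fin r) → 0 ℕ.< d i) ×
    ((i j : Fin r) → (+ d i) * A i j ≡ (+ d j) * A j i)

record IsCartan {r : ℕ} (A : Matrix r) : Set where
  field
    diag      : (i : Fin r) → A i i ≡ + 2
    offdiag   : (i j : Fin r) → i ≢ j → A i j ≤ + 0
    zero-sym  : (i j : Fin r) → (A i j ≡ + 0) ⇔ (A j i ≡ + 0)
    symmetrisable : Symmetrisable A

StrictlyIncreasing : {k r : ℕ} → (Fin k → Fin r) → Set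
StrictlyIncreasing {k} f = (a b : Fin k) → a F.< b → f a F.< f b

-- finite type: every principal minor (determinant of the submatrix on
-- rows/columns indexed by a subset of [1,r], listed increasingly) is positive
FiniteType : {r : ℕ} → Matrix r → Set
FiniteType {r} A =
  (k : ℕ) → (f : Fin k → Fin r) → StrictlyIncreasing f →
  + 0 < det k (λ a b → A (f a) (f b))

Indecomposable : {r : ℕ} → Matrix r → Set
Indecomposable {r} A =
  ¬ (Σ (Fin r → Bool) λ I →
       (∃ λ i → I i ≡ true) × (∃ λ j → I j ≡ false) ×
       ((i j : Fin r) → I i ≡ true → I j ≡ false → A i j ≡ + 0))

-- Z^max_{≥0}-valued Y-frieze pattern associated to A (relation written out
-- in the tropical semiring, with indices shifted to Fin r)
IsTropicalYFrieze : {r : ℕ} → Matrix r → (Fin r → ℤ → ℕ) → Set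
IsTropicalYFrieze {r} A k =
  (i : Fin r) (m : ℤ) →
    + (k i m ℕ.+ k i (m + + 1)) ≡
      ∑ r (λ j → if< i j ((- A j i) * ((+ 0) ⊔ (+ k j m))))
    + ∑ r (λ j → if< j i ((- A j i) * ((+ 0) ⊔ (+ k j (m + + 1)))))
  where
    if< : Fin r → Fin r → ℤ → ℤ
    if< a b x with toℕ a ℕ.<? toℕ b
    ... | Relation.Nullary.yes _ = x
    ... | Relation.Nullary.no _  = + 0

-- For k ≥ 0 the maxima disappear and the frieze relation becomes linear: it says that
-- k(·, m + 1) arises from k(·, m) by applying the simple reflections of A one after another,
-- i.e. by a Coxeter transformation. The reflections preserve the quadratic form of the
-- symmetrised Cartan matrix, which is positive definite since A has finite type (Sylvester's
-- criterion, proved by completing the square and Chiò condensation). So the orbit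
-- k(·, m), k(·, m + 1), … stays in a bounded set of integer vectors and returns to an earlier
-- value. The sum over one period is then fixed by the Coxeter transformation, so its form
-- vanishes and it is zero; its terms are nonnegative, so the orbit passes through 0, and
-- invariance of the form forces k(·, m) = 0.

module Submission where

open import Defs
open import Data.Nat using (ℕ)
open import Data.Fin using (Fin)
open import Data.Integer using (ℤ)
open import Relation.Binary.PropositionalEquality using (_≡_)

open import Data.Nat as ℕ using (zero; suc)
import Data.Nat.Properties as ℕ
open import Data.Integer using (+_; -[1+_]; -_; _+_; _-_; _*_; _≤_; _<_; ∣_∣; +≤+; +<+)
import Data.Integer.Properties as ℤ
open import Data.Integer.Tactic.RingSolver using (solve-∀)
open import Data.Fin as Fin using (zero; suc; toℕ; punchIn; punchOut)
import Data.Fin.Properties as Fin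
open import Data.Product using (∃; ∃₂; _×_; _,_; proj₁; proj₂)
open import Data.Sum using (inj₁; inj₂)
open import Data.Empty using (⊥-elim)
open import Function using (_∘_)
open import Relation.Nullary using (¬_; yes; no)
open import Relation.Binary.Definitions using (tri<; tri≈; tri>)
open import Relation.Binary.PropositionalEquality
  using (_≢_; _≗_; refl; sym; trans; cong; cong₂; subst; module ≡-Reasoning)
open import Algebra.Properties.CommutativeMonoid.Sum ℤ.*-1-commutativeMonoid
  using () renaming (sum to ∏; sum-remove to ∏-remove)
open import Algebra.Properties.AbelianGroup ℤ.+-0-abelianGroup
  using (inverseˡ-unique) renaming (∙-cancelʳ to +-cancelʳ)

*-positive : ∀ {a b} → + 0 < a → + 0 < b → + 0 < a * b
*-positive {+ suc m} {+ suc n} _ _        = +<+ (ℕ.s≤s ℕ.z≤n)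
*-positive {+ zero}            (+<+ ())
*-positive {+ suc m} {+ zero}  _ (+<+ ())

positive-*-cancelˡ : ∀ a b → + 0 < a → + 0 < a * b → + 0 < b
positive-*-cancelˡ (+ suc m) (+ zero)  _ ab>0 = subst (+ 0 <_) (ℤ.*-zeroʳ (+ suc m)) ab>0
positive-*-cancelˡ (+ suc m) (+ suc n) _ _    = +<+ (ℕ.s≤s ℕ.z≤n)
positive-*-cancelˡ (+ suc m) -[1+ n ]  _ ()
positive-*-cancelˡ (+ zero)  _         (+<+ ())

*-cancelʳ-positive : ∀ a b c → + 0 < c → a * c ≡ b * c → a ≡ b
*-cancelʳ-positive a b (+ suc n) _ eq = ℤ.*-cancelʳ-≡ a b (+ suc n) eq
*-cancelʳ-positive a b (+ zero)  (+<+ ()) _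

square≡+∣∣² : ∀ x → x * x ≡ + (∣ x ∣ ℕ.* ∣ x ∣)
square≡+∣∣² (+ n)    = ℤ.+◃n≡+n (n ℕ.* n)
square≡+∣∣² -[1+ n ] = refl

square-nonNegative : ∀ x → + 0 ≤ x * x
square-nonNegative x rewrite square≡+∣∣² x = +≤+ ℕ.z≤n

square≡0⇒≡0 : ∀ x → x * x ≡ + 0 → x ≡ + 0
square≡0⇒≡0 x xx≡0 with ℤ.i*j≡0⇒i≡0∨j≡0 x xx≡0
... | inj₁ x≡0 = x≡0
... | inj₂ x≡0 = x≡0

nonNegative-*-cancelˡ : ∀ a b → + 0 < a → + 0 ≤ a * b → + 0 ≤ b
nonNegative-*-cancelˡ a         (+ n)    _        _  = +≤+ ℕ.z≤n
nonNegative-*-cancelˡ (+ suc m) -[1+ n ] _        ()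
nonNegative-*-cancelˡ (+ zero)  -[1+ n ] (+<+ ()) _

positive-*≡0 : ∀ a b → + 0 < a → a * b ≡ + 0 → b ≡ + 0
positive-*≡0 a b a>0 ab≡0 with ℤ.i*j≡0⇒i≡0∨j≡0 a ab≡0
... | inj₁ refl = ⊥-elim (ℤ.<-irrefl refl a>0)
... | inj₂ b≡0  = b≡0

nonNegative-+≡0 : ∀ {a b} → + 0 ≤ a → + 0 ≤ b → a + b ≡ + 0 → a ≡ + 0 × b ≡ + 0
nonNegative-+≡0 {+ m} {+ n} _ _ m+n≡0 =
  cong +_ (ℕ.m+n≡0⇒m≡0 m (ℤ.+-injective m+n≡0)) , cong +_ (ℕ.m+n≡0⇒n≡0 m (ℤ.+-injective m+n≡0))

positive-*-≤ : ∀ a {b} q → + 0 < a → b ≤ + q → a * b ≤ + (∣ a ∣ ℕ.* q)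
positive-*-≤ (+ suc m) q _ b≤q = subst (_ ≤_) (sym (ℤ.pos-* (suc m) q)) (ℤ.*-monoˡ-≤-nonNeg (+ suc m) b≤q)
positive-*-≤ (+ zero)  q (+<+ ()) _

∣x∣≤∣a*x∣ : ∀ a x → + 0 < a → ∣ x ∣ ℕ.≤ ∣ a * x ∣
∣x∣≤∣a*x∣ (+ suc m) x _ = subst (∣ x ∣ ℕ.≤_) (sym (ℤ.abs-* (+ suc m) x)) (ℕ.m≤n*m ∣ x ∣ (suc m))
∣x∣≤∣a*x∣ (+ zero)  x (+<+ ())

n≤n*n : ∀ n → n ℕ.≤ n ℕ.* n
n≤n*n zero    = ℕ.z≤n
n≤n*n (suc n) = ℕ.m≤m*n (suc n) (suc n)

∑-cong : ∀ n {f g : Fin n → ℤ} → f ≗ g → ∑ n f ≡ ∑ n g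
∑-cong zero    f≗g = refl
∑-cong (suc n) f≗g = cong₂ _+_ (f≗g zero) (∑-cong n (f≗g ∘ suc))

∑-+ : ∀ n (f g : Fin n → ℤ) → ∑ n (λ i → f i + g i) ≡ ∑ n f + ∑ n g
∑-+ zero    f g = refl
∑-+ (suc n) f g rewrite ∑-+ n (f ∘ suc) (g ∘ suc) = interchange (f zero) (g zero) _ _
  where
  interchange : ∀ a b c d → (a + b) + (c + d) ≡ (a + c) + (b + d)
  interchange = solve-∀

∑-*ˡ : ∀ n c (f : Fin n → ℤ) → ∑ n (λ i → c * f i) ≡ c * ∑ n f
∑-*ˡ zero    c f = sym (ℤ.*-zeroʳ c)
∑-*ˡ (suc n) c f rewrite ∑-*ˡ n c (f ∘ suc) = sym (ℤ.*-distribˡ-+ c (f zero) _)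

∑-linear : ∀ n a b (f g : Fin n → ℤ) → ∑ n (λ i → a * f i + b * g i) ≡ a * ∑ n f + b * ∑ n g
∑-linear n a b f g = trans (∑-+ n _ _) (cong₂ _+_ (∑-*ˡ n a f) (∑-*ˡ n b g))

∑-zero : ∀ n {f : Fin n → ℤ} → (∀ i → f i ≡ + 0) → ∑ n f ≡ + 0
∑-zero zero    f≡0 = refl
∑-zero (suc n) f≡0 rewrite f≡0 zero = trans (ℤ.+-identityˡ _) (∑-zero n (f≡0 ∘ suc))

∑-single : ∀ n (f : Fin n → ℤ) s → (∀ j → j ≢ s → f j ≡ + 0) → ∑ n f ≡ f s
∑-single (suc n) f zero    f≡0 rewrite ∑-zero n (λ j → f≡0 (suc j) λ ()) = ℤ.+-identityʳ _
∑-single (suc n) f (suc s) f≡0 rewrite f≡0 zero (λ ()) =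
  trans (ℤ.+-identityˡ _) (∑-single n (f ∘ suc) s (λ j j≢s → f≡0 (suc j) (j≢s ∘ Fin.suc-injective)))

∑-pair : ∀ n (f : Fin n → ℤ) p q → p ≢ q → (∀ j → j ≢ p → j ≢ q → f j ≡ + 0) → ∑ n f ≡ f p + f q
∑-pair (suc n) f zero    zero    p≢q f≡0 = ⊥-elim (p≢q refl)
∑-pair (suc n) f zero    (suc q) p≢q f≡0 =
  cong (λ x → f zero + x) (∑-single n (f ∘ suc) q (λ j j≢q → f≡0 (suc j) (λ ()) (j≢q ∘ Fin.suc-injective)))
∑-pair (suc n) f (suc p) zero    p≢q f≡0 =
  trans (ℤ.+-comm (f zero) _)
    (cong (_+ f zero) (∑-single n (f ∘ suc) p (λ j j≢p → f≡0 (suc j) (j≢p ∘ Fin.suc-injective) (λ ()))))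
∑-pair (suc n) f (suc p) (suc q) p≢q f≡0 rewrite f≡0 zero (λ ()) (λ ()) =
  trans (ℤ.+-identityˡ _)
    (∑-pair n (f ∘ suc) p q (p≢q ∘ cong suc)
      (λ j j≢p j≢q → f≡0 (suc j) (j≢p ∘ Fin.suc-injective) (j≢q ∘ Fin.suc-injective)))

∑-neg : ∀ n (f : Fin n → ℤ) → ∑ n (λ j → - f j) ≡ - ∑ n f
∑-neg zero    f = refl
∑-neg (suc n) f rewrite ∑-neg n (f ∘ suc) = sym (ℤ.neg-distrib-+ (f zero) (∑ n (f ∘ suc)))

δ : ∀ {n} → Fin n → Fin n → ℤ
δ σ j with j Fin.≟ σ
... | yes _ = + 1
... | no _  = + 0

δ-diag : ∀ {n} (σ : Fin n) → δ σ σ ≡ + 1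
δ-diag σ with σ Fin.≟ σ
... | yes _  = refl
... | no σ≢σ = ⊥-elim (σ≢σ refl)

δ-off : ∀ {n} {σ j : Fin n} → j ≢ σ → δ σ j ≡ + 0
δ-off {σ = σ} {j} j≢σ with j Fin.≟ σ
... | yes j≡σ = ⊥-elim (j≢σ j≡σ)
... | no _    = refl

∑-δ : ∀ n (σ : Fin n) (f : Fin n → ℤ) → ∑ n (λ j → δ σ j * f j) ≡ f σ
∑-δ n σ f = trans (∑-single n _ σ λ j j≢σ → trans (cong (_* f j) (δ-off j≢σ)) (ℤ.*-zeroˡ (f j)))
                  (trans (cong (_* f σ) (δ-diag σ)) (ℤ.*-identityˡ (f σ)))

∏-positive : ∀ n (f : Fin n → ℤ) → (∀ i → + 0 < f i) → + 0 < ∏ f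
∏-positive zero    f f>0 = +<+ (ℕ.s≤s ℕ.z≤n)
∏-positive (suc n) f f>0 = *-positive (f>0 zero) (∏-positive n (f ∘ suc) (f>0 ∘ suc))

∏-except : ∀ {n} → (Fin n → ℤ) → Fin n → ℤ
∏-except {suc n} f i = ∏ (f ∘ punchIn i)

*-∏-except : ∀ {n} (f : Fin n → ℤ) i → f i * ∏-except f i ≡ ∏ f
*-∏-except {suc n} f i = sym (∏-remove {i = i} f)

∏-except-positive : ∀ {n} (f : Fin n → ℤ) → (∀ i → + 0 < f i) → ∀ i → + 0 < ∏-except f i
∏-except-positive {suc n} f f>0 i = ∏-positive n (f ∘ punchIn i) (f>0 ∘ punchIn i)

sumUpTo : ℕ → (ℕ → ℤ) → ℤ
sumUpTo zero    f = + 0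
sumUpTo (suc L) f = f 0 + sumUpTo L (f ∘ ℕ.suc)

sumUpTo-shift : ∀ L (f : ℕ → ℤ) → sumUpTo L (f ∘ ℕ.suc) + f 0 ≡ sumUpTo L f + f L
sumUpTo-shift zero    f = refl
sumUpTo-shift (suc L) f = begin
  (f 1 + sumUpTo L (f ∘ ℕ.suc ∘ ℕ.suc)) + f 0   ≡⟨ cong (_+ f 0) (ℤ.+-comm (f 1) _) ⟩
  (sumUpTo L (f ∘ ℕ.suc ∘ ℕ.suc) + f 1) + f 0   ≡⟨ cong (_+ f 0) (sumUpTo-shift L (f ∘ ℕ.suc)) ⟩
  (sumUpTo L (f ∘ ℕ.suc) + f (suc L)) + f 0   ≡⟨ rotate (sumUpTo L (f ∘ ℕ.suc)) (f (suc L)) (f 0) ⟩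
  (f 0 + sumUpTo L (f ∘ ℕ.suc)) + f (suc L)   ∎
  where
  open ≡-Reasoning
  rotate : ∀ a b c → (a + b) + c ≡ (c + a) + b
  rotate = solve-∀

sumUpTo-nonNegative : ∀ L (f : ℕ → ℤ) → (∀ t → + 0 ≤ f t) → + 0 ≤ sumUpTo L f
sumUpTo-nonNegative zero    f f≥0 = ℤ.≤-refl
sumUpTo-nonNegative (suc L) f f≥0 = ℤ.+-mono-≤ (f≥0 0) (sumUpTo-nonNegative L (f ∘ ℕ.suc) (f≥0 ∘ ℕ.suc))

mix : ∀ {n} {A : Set} → ℕ → (Fin n → A) → (Fin n → A) → Fin n → A
mix s u v j with toℕ j ℕ.<? s
... | yes _ = v j
... | no _  = u j

module _ {n} {A : Set} {s : ℕ} {u v : Fin n → A} where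

  mix-below : ∀ {j} → toℕ j ℕ.< s → mix s u v j ≡ v j
  mix-below {j} j<s with toℕ j ℕ.<? s
  ... | yes _  = refl
  ... | no j≮s = ⊥-elim (j≮s j<s)

  mix-above : ∀ {j} → ¬ toℕ j ℕ.< s → mix s u v j ≡ u j
  mix-above {j} j≮s with toℕ j ℕ.<? s
  ... | yes j<s = ⊥-elim (j≮s j<s)
  ... | no _    = refl

  mix-suc : ∀ {j} → toℕ j ≢ s → mix (suc s) u v j ≡ mix s u v j
  mix-suc {j} j≢s with toℕ j ℕ.<? suc s | toℕ j ℕ.<? s
  ... | yes _     | yes _   = refl
  ... | no _      | no _    = refl
  ... | yes j<1+s | no j≮s  = ⊥-elim (j≮s (ℕ.≤∧≢⇒< (ℕ.≤-pred j<1+s) j≢s))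
  ... | no j≮1+s  | yes j<s = ⊥-elim (j≮1+s (ℕ.m<n⇒m<1+n j<s))

mix-zero : ∀ {n} {A : Set} (u v : Fin n → A) → mix 0 u v ≗ u
mix-zero u v j = mix-above {s = 0} {u} {v} {j} λ ()

mix-all : ∀ {n} {A : Set} (u v : Fin n → A) → mix n u v ≗ v
mix-all u v j = mix-below {s = _} {u} {v} (Fin.toℕ<n j)

mix-same : ∀ {n} {A : Set} s (u : Fin n → A) → mix s u u ≗ u
mix-same s u j with toℕ j ℕ.<? s
... | yes _ = refl
... | no _  = refl

mix-+ : ∀ {n} s (u u′ v v′ : Fin n → ℤ) j →
        mix s (λ i → u i + u′ i) (λ i → v i + v′ i) j ≡ mix s u v j + mix s u′ v′ j
mix-+ s u u′ v v′ j with toℕ j ℕ.<? s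
... | yes _ = refl
... | no _  = refl

-- Determinants

Adjacent : ∀ {n} → Fin n → Fin n → Set
Adjacent p q = toℕ q ≡ suc (toℕ p)

adjacent⇒≢ : ∀ {n} {p q : Fin n} → Adjacent p q → p ≢ q
adjacent⇒≢ adj refl = ℕ.1+n≢n (sym adj)

punchOut-adjacent : ∀ {n} {j p q : Fin (suc n)} (j≢p : j ≢ p) (j≢q : j ≢ q) →
                    Adjacent p q → Adjacent (punchOut j≢p) (punchOut j≢q)
punchOut-adjacent {j = zero}  {zero}  j≢p j≢q adj = ⊥-elim (j≢p refl)
punchOut-adjacent {j = zero}  {suc p} {suc q} j≢p j≢q adj = ℕ.suc-injective adj
punchOut-adjacent {n = suc n} {suc zero}    {zero} {suc zero} j≢p j≢q adj = ⊥-elim (j≢q refl)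
punchOut-adjacent {n = suc (suc n)} {suc (suc j)} {zero} {suc zero} j≢p j≢q adj = refl
punchOut-adjacent {n = suc n} {suc j} {suc p} {suc q} j≢p j≢q adj =
  cong suc (punchOut-adjacent (j≢p ∘ cong suc) (j≢q ∘ cong suc) (ℕ.suc-injective adj))

punchIn-adjacent : ∀ {n} {A : Set} (f : Fin (suc n) → A) {p q : Fin (suc n)} →
                   Adjacent p q → f p ≡ f q → f ∘ punchIn p ≗ f ∘ punchIn q
punchIn-adjacent f {zero}  {suc zero} adj fp≡fq zero    = sym fp≡fq
punchIn-adjacent f {zero}  {suc zero} adj fp≡fq (suc b) = refl
punchIn-adjacent f {suc p} {suc q}    adj fp≡fq zero    = refl
punchIn-adjacent f {suc p} {suc q}    adj fp≡fq (suc b) =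
  punchIn-adjacent (f ∘ suc) (ℕ.suc-injective adj) fp≡fq b

minor : ∀ {n} → Fin (suc n) → Matrix (suc n) → Matrix n
minor j M a b = M (suc a) (punchIn j b)

laplaceTerm : ∀ {n} → Matrix (suc n) → Fin (suc n) → ℤ
laplaceTerm {n} M j = sgn (toℕ j) * (M zero j * det n (minor j M))

sgn-suc : ∀ n → sgn (suc n) ≡ - sgn n
sgn-suc zero    = refl
sgn-suc (suc n) = trans (sym (ℤ.neg-involutive _)) (cong -_ (sym (sgn-suc n)))

det-cong : ∀ n {M N : Matrix n} → (∀ a b → M a b ≡ N a b) → det n M ≡ det n N
det-cong zero    M≡N = refl
det-cong (suc n) M≡N = ∑-cong (suc n) λ j →
  cong₂ (λ x y → sgn (toℕ j) * (x * y)) (M≡N zero j) (det-cong n λ a b → M≡N (suc a) (punchIn j b))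

punchIn-≢ : ∀ {n} {i j : Fin (suc n)} {k : Fin n} (i≢j : i ≢ j) → k ≢ punchOut i≢j → punchIn i k ≢ j
punchIn-≢ {i = i} i≢j k≢ eq = k≢ (Fin.punchIn-injective i _ _ (trans eq (sym (Fin.punchIn-punchOut i≢j))))

det-linear : ∀ n (M M₁ M₂ : Matrix n) c α β →
             (∀ a b → b ≢ c → M a b ≡ M₁ a b) → (∀ a b → b ≢ c → M a b ≡ M₂ a b) →
             (∀ a → M a c ≡ α * M₁ a c + β * M₂ a c) →
             det n M ≡ α * det n M₁ + β * det n M₂
det-linear (suc n) M M₁ M₂ c α β M≡M₁ M≡M₂ M≡αM₁+βM₂ =
  trans (∑-cong (suc n) term) (∑-linear (suc n) α β (laplaceTerm M₁) (laplaceTerm M₂))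
  where
  open ≡-Reasoning
  term : ∀ j → laplaceTerm M j ≡ α * laplaceTerm M₁ j + β * laplaceTerm M₂ j
  term j with j Fin.≟ c
  ... | yes refl = begin
    sgn (toℕ j) * (M zero j * det n (minor j M))
      ≡⟨ cong (λ x → sgn (toℕ j) * (x * det n (minor j M))) (M≡αM₁+βM₂ zero) ⟩
    sgn (toℕ j) * ((α * M₁ zero j + β * M₂ zero j) * det n (minor j M))
      ≡⟨ distrib α β (sgn (toℕ j)) (M₁ zero j) (M₂ zero j) (det n (minor j M)) ⟩
    α * (sgn (toℕ j) * (M₁ zero j * det n (minor j M))) + β * (sgn (toℕ j) * (M₂ zero j * det n (minor j M)))
      ≡⟨ cong₂ (λ d₁ d₂ → α * (sgn (toℕ j) * (M₁ zero j * d₁)) + β * (sgn (toℕ j) * (M₂ zero j * d₂)))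
               (det-cong n λ a b → M≡M₁ (suc a) (punchIn j b) (Fin.punchInᵢ≢i j b))
               (det-cong n λ a b → M≡M₂ (suc a) (punchIn j b) (Fin.punchInᵢ≢i j b)) ⟩
    α * laplaceTerm M₁ j + β * laplaceTerm M₂ j ∎
    where
    distrib : ∀ a b s x y d → s * ((a * x + b * y) * d) ≡ a * (s * (x * d)) + b * (s * (y * d))
    distrib = solve-∀
  ... | no j≢c = begin
    sgn (toℕ j) * (M zero j * det n (minor j M))
      ≡⟨ cong (λ d → sgn (toℕ j) * (M zero j * d))
              (det-linear n (minor j M) (minor j M₁) (minor j M₂) (punchOut j≢c) α β
                 (λ a b b≢ → M≡M₁ (suc a) (punchIn j b) (punchIn-≢ j≢c b≢))
                 (λ a b b≢ → M≡M₂ (suc a) (punchIn j b) (punchIn-≢ j≢c b≢))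
                 (λ a → subst (λ z → M (suc a) z ≡ α * M₁ (suc a) z + β * M₂ (suc a) z)
                              (sym (Fin.punchIn-punchOut j≢c)) (M≡αM₁+βM₂ (suc a)))) ⟩
    sgn (toℕ j) * (M zero j * (α * det n (minor j M₁) + β * det n (minor j M₂)))
      ≡⟨ distrib α β (sgn (toℕ j)) (M zero j) _ _ ⟩
    α * (sgn (toℕ j) * (M zero j * det n (minor j M₁))) + β * (sgn (toℕ j) * (M zero j * det n (minor j M₂)))
      ≡⟨ cong₂ (λ x y → α * (sgn (toℕ j) * (x * det n (minor j M₁))) + β * (sgn (toℕ j) * (y * det n (minor j M₂))))
               (M≡M₁ zero j j≢c) (M≡M₂ zero j j≢c) ⟩
    α * laplaceTerm M₁ j + β * laplaceTerm M₂ j ∎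
    where
    distrib : ∀ a b s x d₁ d₂ → s * (x * (a * d₁ + b * d₂)) ≡ a * (s * (x * d₁)) + b * (s * (x * d₂))
    distrib = solve-∀

det-adjacent-columns : ∀ n (M : Matrix n) {p q} → Adjacent p q → (∀ a → M a p ≡ M a q) → det n M ≡ + 0
det-adjacent-columns (suc n) M {p} {q} adj Mp≡Mq = begin
  det (suc n) M                                   ≡⟨ ∑-pair (suc n) (laplaceTerm M) p q (adjacent⇒≢ adj) vanish ⟩
  laplaceTerm M p + laplaceTerm M q               ≡⟨ cong₂ (λ s x → laplaceTerm M p + s * (x * det n (minor q M)))
                                                           (trans (cong sgn adj) (sgn-suc (toℕ p))) (sym (Mp≡Mq zero)) ⟩
  laplaceTerm M p + - sgn (toℕ p) * (M zero p * det n (minor q M))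
                                                  ≡⟨ cong (λ d → laplaceTerm M p + - sgn (toℕ p) * (M zero p * d))
                                                          (det-cong n λ a b →
                                                             sym (punchIn-adjacent (M (suc a)) adj (Mp≡Mq (suc a)) b)) ⟩
  laplaceTerm M p + - sgn (toℕ p) * (M zero p * det n (minor p M))
                                                  ≡⟨ cancel (sgn (toℕ p)) (M zero p * det n (minor p M)) ⟩
  + 0                                             ∎
  where
  open ≡-Reasoning
  cancel : ∀ s x → s * x + - s * x ≡ + 0
  cancel = solve-∀
  vanish : ∀ j → j ≢ p → j ≢ q → laplaceTerm M j ≡ + 0
  vanish j j≢p j≢q = begin
    sgn (toℕ j) * (M zero j * det n (minor j M))  ≡⟨ cong (λ d → sgn (toℕ j) * (M zero j * d)) minor-singular ⟩
    sgn (toℕ j) * (M zero j * + 0)                 ≡⟨ cong (sgn (toℕ j) *_) (ℤ.*-zeroʳ (M zero j)) ⟩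
    sgn (toℕ j) * + 0                              ≡⟨ ℤ.*-zeroʳ (sgn (toℕ j)) ⟩
    + 0                                            ∎
    where
    minor-singular : det n (minor j M) ≡ + 0
    minor-singular = det-adjacent-columns n (minor j M) (punchOut-adjacent j≢p j≢q adj) λ a →
      trans (cong (M (suc a)) (Fin.punchIn-punchOut j≢p))
        (trans (Mp≡Mq (suc a)) (cong (M (suc a)) (sym (Fin.punchIn-punchOut j≢q))))

setColumn : ∀ {n} → Matrix n → Fin n → (Fin n → ℤ) → Matrix n
setColumn M c u a b with b Fin.≟ c
... | yes _ = u a
... | no _  = M a b

module _ {n} (M : Matrix n) (c : Fin n) (u : Fin n → ℤ) (a : Fin n) where

  setColumn-≡ : setColumn M c u a c ≡ u a
  setColumn-≡ with c Fin.≟ c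
  ... | yes _  = refl
  ... | no c≢c = ⊥-elim (c≢c refl)

  setColumn-≢ : ∀ {b} → b ≢ c → setColumn M c u a b ≡ M a b
  setColumn-≢ {b} b≢c with b Fin.≟ c
  ... | yes b≡c = ⊥-elim (b≢c b≡c)
  ... | no _    = refl

det-setColumn-+ : ∀ n (M : Matrix n) c (u v : Fin n → ℤ) →
                  det n (setColumn M c (λ a → u a + v a)) ≡ det n (setColumn M c u) + det n (setColumn M c v)
det-setColumn-+ n M c u v =
  trans (det-linear n _ (setColumn M c u) (setColumn M c v) c (+ 1) (+ 1) (off u) (off v) at)
        (cong₂ _+_ (ℤ.*-identityˡ (det n (setColumn M c u))) (ℤ.*-identityˡ (det n (setColumn M c v))))
  where
  off : ∀ w a b → b ≢ c → setColumn M c (λ a → u a + v a) a b ≡ setColumn M c w a b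
  off w a b b≢c = trans (setColumn-≢ M c _ a b≢c) (sym (setColumn-≢ M c w a b≢c))
  at : ∀ a → setColumn M c (λ a → u a + v a) a c ≡ + 1 * setColumn M c u a c + + 1 * setColumn M c v a c
  at a rewrite setColumn-≡ M c (λ a → u a + v a) a | setColumn-≡ M c u a | setColumn-≡ M c v a =
    sym (cong₂ _+_ (ℤ.*-identityˡ (u a)) (ℤ.*-identityˡ (v a)))

setColumn-comm : ∀ {n} (M : Matrix n) {p q} → p ≢ q → ∀ u v a b →
                 setColumn (setColumn M p u) q v a b ≡ setColumn (setColumn M q v) p u a b
setColumn-comm M {p} {q} p≢q u v a b with p Fin.≟ b | q Fin.≟ b
... | yes refl | _ = trans (setColumn-≢ _ q v a p≢q)
                       (trans (setColumn-≡ M p u a) (sym (setColumn-≡ _ p u a)))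
... | no p≢b | yes refl = trans (setColumn-≡ _ q v a)
                            (trans (sym (setColumn-≡ M q v a)) (sym (setColumn-≢ _ p u a (p≢b ∘ sym))))
... | no p≢b | no q≢b = trans (setColumn-≢ _ q v a (q≢b ∘ sym))
                          (trans (setColumn-≢ M p u a (p≢b ∘ sym))
                            (sym (trans (setColumn-≢ _ p u a (p≢b ∘ sym)) (setColumn-≢ M q v a (q≢b ∘ sym)))))

det-swap-adjacent : ∀ n (M : Matrix n) {p q} → Adjacent p q → ∀ u v →
                    det n (setColumn (setColumn M p u) q v) ≡ - det n (setColumn (setColumn M p v) q u)
det-swap-adjacent n M {p} {q} adj u v = inverseˡ-unique (D u v) (D v u) (begin
  D u v + D v u                   ≡⟨ unit-padding (D u v) (D v u) ⟨
  (+ 0 + D u v) + (D v u + + 0)   ≡⟨ cong₂ (λ x y → (x + D u v) + (D v u + y)) (D-diag u) (D-diag v) ⟨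
  (D u u + D u v) + (D v u + D v v) ≡⟨ cong₂ _+_ (D-+ʳ u u v) (D-+ʳ v u v) ⟨
  D u (u +ᵛ v) + D v (u +ᵛ v)     ≡⟨ D-+ˡ u v (u +ᵛ v) ⟨
  D (u +ᵛ v) (u +ᵛ v)             ≡⟨ D-diag (u +ᵛ v) ⟩
  + 0                             ∎)
  where
  open ≡-Reasoning
  infixl 6 _+ᵛ_
  _+ᵛ_ : (Fin n → ℤ) → (Fin n → ℤ) → Fin n → ℤ
  (x +ᵛ y) a = x a + y a
  D : (Fin n → ℤ) → (Fin n → ℤ) → ℤ
  D x y = det n (setColumn (setColumn M p x) q y)
  p≢q = adjacent⇒≢ adj
  D-diag : ∀ x → D x x ≡ + 0
  D-diag x = det-adjacent-columns n _ adj λ a →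
    trans (setColumn-≢ _ q x a p≢q) (trans (setColumn-≡ M p x a) (sym (setColumn-≡ _ q x a)))
  D-+ʳ : ∀ x y z → D x (y +ᵛ z) ≡ D x y + D x z
  D-+ʳ x y z = det-setColumn-+ n (setColumn M p x) q y z
  D-+ˡ : ∀ x y z → D (x +ᵛ y) z ≡ D x z + D y z
  D-+ˡ x y z = trans (det-cong n (setColumn-comm M p≢q (x +ᵛ y) z))
    (trans (det-setColumn-+ n (setColumn M q z) p x y)
      (sym (cong₂ _+_ (det-cong n (setColumn-comm M p≢q x z)) (det-cong n (setColumn-comm M p≢q y z)))))
  unit-padding : ∀ x y → (+ 0 + x) + (y + + 0) ≡ x + y
  unit-padding = solve-∀

det-first-column-repeated : ∀ n (M : Matrix (suc n)) q → q ≢ zero → (∀ a → M a zero ≡ M a q) → det (suc n) M ≡ + 0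
det-first-column-repeated n M zero    q≢0 _     = ⊥-elim (q≢0 refl)
det-first-column-repeated n M (suc c) _   M0≡Mq = go (toℕ c) M c refl M0≡Mq
  where
  go : ∀ d (M : Matrix (suc n)) c → toℕ c ≡ d → (∀ a → M a zero ≡ M a (suc c)) → det (suc n) M ≡ + 0
  go zero    M c       c≡0   M0≡Mq = det-adjacent-columns (suc n) M (cong suc c≡0) M0≡Mq
  go (suc d) M (suc c) c≡1+d M0≡Mq = begin
    det (suc n) M                                               ≡⟨ det-cong (suc n) restore ⟨
    det (suc n) (setColumn (setColumn M p (col p)) q (col q))   ≡⟨ det-swap-adjacent (suc n) M adj (col p) (col q) ⟩
    - det (suc n) M′                                            ≡⟨ cong -_ (go d M′ (Fin.inject₁ c) p-distance M′0≡M′p) ⟩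
    + 0                                                         ∎
    where
    open ≡-Reasoning
    p q : Fin (suc n)
    p = suc (Fin.inject₁ c)
    q = suc (suc c)
    col : Fin (suc n) → Fin (suc n) → ℤ
    col b a = M a b
    adj : Adjacent p q
    adj = cong (λ i → suc (suc i)) (sym (Fin.toℕ-inject₁ c))
    p≢q : p ≢ q
    p≢q = adjacent⇒≢ adj
    M′ : Matrix (suc n)
    M′ = setColumn (setColumn M p (col q)) q (col p)
    p-distance : toℕ (Fin.inject₁ c) ≡ d
    p-distance = trans (Fin.toℕ-inject₁ c) (ℕ.suc-injective c≡1+d)
    restore : ∀ a b → setColumn (setColumn M p (col p)) q (col q) a b ≡ M a b
    restore a b with q Fin.≟ b | p Fin.≟ b
    ... | yes refl | _        = setColumn-≡ _ q (col q) a
    ... | no q≢b   | yes refl = trans (setColumn-≢ _ q (col q) a (q≢b ∘ sym)) (setColumn-≡ M p (col p) a)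
    ... | no q≢b   | no p≢b   = trans (setColumn-≢ _ q (col q) a (q≢b ∘ sym)) (setColumn-≢ M p (col p) a (p≢b ∘ sym))
    M′0≡M′p : ∀ a → M′ a zero ≡ M′ a (suc (Fin.inject₁ c))
    M′0≡M′p a = begin
      M′ a zero  ≡⟨ setColumn-≢ (setColumn M p (col q)) q (col p) a {zero} (λ ()) ⟩
      setColumn M p (col q) a zero ≡⟨ setColumn-≢ M p (col q) a {zero} (λ ()) ⟩
      M a zero   ≡⟨ M0≡Mq a ⟩
      M a q      ≡⟨ setColumn-≡ M p (col q) a ⟨
      setColumn M p (col q) a p ≡⟨ setColumn-≢ _ q (col p) a p≢q ⟨
      M′ a p     ∎

det-add-first-column : ∀ n (M M′ : Matrix (suc n)) c α β → c ≢ zero →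
                       (∀ a b → b ≢ c → M′ a b ≡ M a b) → (∀ a → M′ a c ≡ α * M a c + β * M a zero) →
                       det (suc n) M′ ≡ α * det (suc n) M
det-add-first-column n M M′ c α β c≢0 M′≡M M′c = begin
  det (suc n) M′                               ≡⟨ det-linear (suc n) M′ M M₀ c α β M′≡M off-c at-c ⟩
  α * det (suc n) M + β * det (suc n) M₀       ≡⟨ cong (λ d → α * det (suc n) M + β * d) M₀-singular ⟩
  α * det (suc n) M + β * + 0                  ≡⟨ cong (λ x → α * det (suc n) M + x) (ℤ.*-zeroʳ β) ⟩
  α * det (suc n) M + + 0                      ≡⟨ ℤ.+-identityʳ _ ⟩
  α * det (suc n) M                            ∎
  where
  open ≡-Reasoning
  M₀ : Matrix (suc n)
  M₀ = setColumn M c (λ a → M a zero)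
  off-c : ∀ a b → b ≢ c → M′ a b ≡ M₀ a b
  off-c a b b≢c = trans (M′≡M a b b≢c) (sym (setColumn-≢ M c _ a b≢c))
  at-c : ∀ a → M′ a c ≡ α * M a c + β * M₀ a c
  at-c a = trans (M′c a) (cong (λ x → α * M a c + β * x) (sym (setColumn-≡ M c _ a)))
  M₀-singular : det (suc n) M₀ ≡ + 0
  M₀-singular = det-first-column-repeated n M₀ c c≢0 λ a →
    trans (setColumn-≢ M c _ a (c≢0 ∘ sym)) (sym (setColumn-≡ M c _ a))

det-scale-columns : ∀ n (M : Matrix n) (l : Fin n → ℤ) → det n (λ a b → M a b * l b) ≡ ∏ l * det n M
det-scale-columns zero    M l = refl
det-scale-columns (suc n) M l = begin
  ∑ (suc n) (λ j → sgn (toℕ j) * ((M zero j * l j) * det n (λ a b → M (suc a) (punchIn j b) * l (punchIn j b))))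
    ≡⟨ ∑-cong (suc n) (λ j → cong (λ d → sgn (toℕ j) * ((M zero j * l j) * d))
                                   (det-scale-columns n (minor j M) (l ∘ punchIn j))) ⟩
  ∑ (suc n) (λ j → sgn (toℕ j) * ((M zero j * l j) * (∏ (l ∘ punchIn j) * det n (minor j M))))
    ≡⟨ ∑-cong (suc n) (λ j → trans (regroup (sgn (toℕ j)) (M zero j) (l j) _ _)
                                   (cong (_* laplaceTerm M j) (sym (∏-remove {i = j} l)))) ⟩
  ∑ (suc n) (λ j → ∏ l * laplaceTerm M j)
    ≡⟨ ∑-*ˡ (suc n) (∏ l) (laplaceTerm M) ⟩
  ∏ l * det (suc n) M ∎
  where
  open ≡-Reasoning
  regroup : ∀ s m x p d → s * ((m * x) * (p * d)) ≡ (x * p) * (s * (m * d))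
  regroup = solve-∀

-- Chiò's column operations, which clear row 0; column 0 itself is dropped.
cleared : ∀ {k} → Matrix (suc k) → Fin (suc k) → Fin k → ℤ
cleared M a c = M zero zero * M a (suc c) - M zero (suc c) * M a zero

condense : ∀ {k} → Matrix (suc k) → Matrix k
condense M a = cleared M (suc a)

partiallyCondensed : ∀ {k} → ℕ → Matrix (suc k) → Matrix (suc k)
partiallyCondensed t M a zero    = M a zero
partiallyCondensed t M a (suc b) = mix t (λ c → M a (suc c)) (cleared M a) b

module _ {k} (M : Matrix (suc k)) where

  partiallyCondensed-zero : ∀ a b → partiallyCondensed 0 M a b ≡ M a b
  partiallyCondensed-zero a zero    = refl
  partiallyCondensed-zero a (suc b) = mix-zero (λ c → M a (suc c)) (cleared M a) b

  det-partiallyCondensed-suc : ∀ t (c : Fin k) → toℕ c ≡ t →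
    det (suc k) (partiallyCondensed (suc t) M) ≡ M zero zero * det (suc k) (partiallyCondensed t M)
  det-partiallyCondensed-suc t c c≡t =
    det-add-first-column k (partiallyCondensed t M) (partiallyCondensed (suc t) M) (suc c)
      (M zero zero) (- M zero (suc c)) (λ ()) off-c at-c
    where
    off-c : ∀ a b → b ≢ suc c → partiallyCondensed (suc t) M a b ≡ partiallyCondensed t M a b
    off-c a zero    _     = refl
    off-c a (suc b) b≢c =
      mix-suc {u = λ c → M a (suc c)} λ b≡t → b≢c (cong suc (Fin.toℕ-injective (trans b≡t (sym c≡t))))
    at-c : ∀ a → partiallyCondensed (suc t) M a (suc c)
               ≡ M zero zero * partiallyCondensed t M a (suc c) + (- M zero (suc c)) * M a zero
    at-c a rewrite mix-below {s = suc t} {λ c → M a (suc c)} {cleared M a} (ℕ.≤-reflexive (cong suc c≡t))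
                 | mix-above {s = t} {λ c → M a (suc c)} {cleared M a} (ℕ.<-irrefl c≡t)
      = sub-as-add (M zero zero) (M a (suc c)) (M zero (suc c)) (M a zero)
      where
      sub-as-add : ∀ x y z w → x * y - z * w ≡ x * y + (- z) * w
      sub-as-add = solve-∀

  det-fullyCondensed : det (suc k) (partiallyCondensed k M) ≡ M zero zero * det k (condense M)
  det-fullyCondensed = begin
    det (suc k) (partiallyCondensed k M)           ≡⟨ ∑-single (suc k) _ zero first-row-vanishes ⟩
    + 1 * (M zero zero * det k (minor zero (partiallyCondensed k M)))
                                                    ≡⟨ ℤ.*-identityˡ _ ⟩
    M zero zero * det k (minor zero (partiallyCondensed k M))
                                                    ≡⟨ cong (M zero zero *_) (det-cong k λ a b → mix-all _ _ b) ⟩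
    M zero zero * det k (condense M)               ∎
    where
    open ≡-Reasoning
    x*y-y*x≡0 : ∀ x y → x * y - y * x ≡ + 0
    x*y-y*x≡0 = solve-∀
    first-row-vanishes : ∀ j → j ≢ zero → laplaceTerm (partiallyCondensed k M) j ≡ + 0
    first-row-vanishes zero    j≢0 = ⊥-elim (j≢0 refl)
    first-row-vanishes (suc b) _
      rewrite mix-all (λ c → M zero (suc c)) (cleared M zero) b | x*y-y*x≡0 (M zero zero) (M zero (suc b))
      = trans (cong (sgn (toℕ (suc b)) *_) (ℤ.*-zeroˡ (det k (minor (suc b) (partiallyCondensed k M)))))
              (ℤ.*-zeroʳ (sgn (toℕ (suc b))))

det-condense-positive : ∀ k (M : Matrix (suc k)) → + 0 < M zero zero → + 0 < det (suc k) M →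
                        + 0 < det k (condense M)
det-condense-positive k M M₀₀>0 detM>0 =
  positive-*-cancelˡ (M zero zero) _ M₀₀>0 (subst (+ 0 <_) (det-fullyCondensed M) (partial k ℕ.≤-refl))
  where
  partial : ∀ t → t ℕ.≤ k → + 0 < det (suc k) (partiallyCondensed t M)
  partial zero    _   = subst (+ 0 <_) (sym (det-cong (suc k) (partiallyCondensed-zero M))) detM>0
  partial (suc t) t<k = subst (+ 0 <_) (sym (det-partiallyCondensed-suc M t (Fin.fromℕ< t<k) (Fin.toℕ-fromℕ< t<k)))
                          (*-positive M₀₀>0 (partial t (ℕ.<⇒≤ t<k)))

-- Positive definiteness of finite-type forms

IsSymmetric : ∀ {n} → Matrix n → Set
IsSymmetric G = ∀ i j → G i j ≡ G j i

infixr 7 _·ᵛ_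
_·ᵛ_ : ∀ {n} → Matrix n → (Fin n → ℤ) → Fin n → ℤ
_·ᵛ_ {n} G x i = ∑ n (λ j → G i j * x j)

quadForm : ∀ {n} → Matrix n → (Fin n → ℤ) → ℤ
quadForm {n} G x = ∑ n (λ i → x i * (G ·ᵛ x) i)

quadForm-cong : ∀ {n} (G : Matrix n) {x y : Fin n → ℤ} → x ≗ y → quadForm G x ≡ quadForm G y
quadForm-cong {n} G x≗y = ∑-cong n λ i → cong₂ _*_ (x≗y i) (∑-cong n λ j → cong (G i j *_) (x≗y j))

quadForm-shift : ∀ n (G : Matrix n) → IsSymmetric G → ∀ (y : Fin n → ℤ) σ τ →
  quadForm G (λ i → y i + δ σ i * τ) ≡ quadForm G y + τ * (+ 2 * (G ·ᵛ y) σ + τ * G σ σ)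
quadForm-shift n G G-sym y σ τ = begin
  quadForm G y′
    ≡⟨ ∑-cong n (λ i → cong (y′ i *_) (Gy′ i)) ⟩
  ∑ n (λ i → y′ i * ((G ·ᵛ y) i + τ * G i σ))
    ≡⟨ ∑-cong n (λ i → trans (expand (y i) (δ σ i) τ ((G ·ᵛ y) i) (G i σ))
                             (cong (λ g → y i * (G ·ᵛ y) i
                                          + (τ * (g * y i) + τ * (δ σ i * (G ·ᵛ y) i + τ * (δ σ i * G i σ))))
                                   (G-sym i σ))) ⟩
  ∑ n (λ i → y i * (G ·ᵛ y) i + (τ * (G σ i * y i) + τ * (δ σ i * (G ·ᵛ y) i + τ * (δ σ i * G i σ))))
    ≡⟨ trans (∑-+ n _ _) (cong (λ t → quadForm G y + t) (trans (∑-+ n _ _) (cong₂ _+_ (∑-*ˡ n τ _) (∑-*ˡ n τ _)))) ⟩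
  quadForm G y + (τ * (G ·ᵛ y) σ + τ * ∑ n (λ i → δ σ i * (G ·ᵛ y) i + τ * (δ σ i * G i σ)))
    ≡⟨ cong (λ t → quadForm G y + (τ * (G ·ᵛ y) σ + τ * t))
            (trans (∑-+ n _ _) (cong₂ _+_ (∑-δ n σ (G ·ᵛ y))
                                          (trans (∑-*ˡ n τ _) (cong (τ *_) (∑-δ n σ (λ i → G i σ)))))) ⟩
  quadForm G y + (τ * (G ·ᵛ y) σ + τ * ((G ·ᵛ y) σ + τ * G σ σ))
    ≡⟨ collect (quadForm G y) τ ((G ·ᵛ y) σ) (G σ σ) ⟩
  quadForm G y + τ * (+ 2 * (G ·ᵛ y) σ + τ * G σ σ) ∎
  where
  open ≡-Reasoning
  y′ : Fin n → ℤ
  y′ i = y i + δ σ i * τ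
  Gy′ : ∀ i → (G ·ᵛ y′) i ≡ (G ·ᵛ y) i + τ * G i σ
  Gy′ i = trans (∑-cong n λ j → distrib (G i j) (y j) (δ σ j) τ)
                (trans (∑-+ n _ _) (cong (λ t → (G ·ᵛ y) i + t) (trans (∑-*ˡ n τ _) (cong (τ *_) (∑-δ n σ (G i))))))
    where
    distrib : ∀ g x e t → g * (x + e * t) ≡ g * x + t * (e * g)
    distrib = solve-∀
  expand : ∀ x e t g h → (x + e * t) * (g + t * h) ≡ x * g + (t * (h * x) + t * (e * g + t * (e * h)))
  expand = solve-∀
  collect : ∀ q t g s → q + (t * g + t * (g + t * s)) ≡ q + t * (+ 2 * g + t * s)
  collect = solve-∀

condense-symmetric : ∀ {n} (G : Matrix (suc n)) → IsSymmetric G → IsSymmetric (condense G)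
condense-symmetric G G-sym a b rewrite G-sym (suc a) (suc b) | G-sym zero (suc b) | G-sym (suc a) zero =
  cong (λ z → G zero zero * G (suc b) (suc a) - z) (ℤ.*-comm (G (suc b) zero) (G zero (suc a)))

module CompletingTheSquare {n} (G : Matrix (suc n)) (G-sym : IsSymmetric G) (x : Fin (suc n) → ℤ) where

  rowTail : ℤ
  rowTail = ∑ n (λ j → G zero (suc j) * x (suc j))

  leading : ℤ
  leading = G zero zero * x zero + rowTail

  private
    G′ : Matrix n
    G′ i j = G (suc i) (suc j)

    r : Fin n → ℤ
    r = G′ ·ᵛ (x ∘ suc)

    R : ℤ
    R = quadForm G′ (x ∘ suc)

    tail-part : ∑ n (λ i → x (suc i) * (G (suc i) zero * x zero + r i)) ≡ x zero * rowTail + + 1 * R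
    tail-part = trans (∑-cong n λ i → trans (expand (x (suc i)) (G (suc i) zero) (x zero) (r i))
                                            (cong (λ g → x zero * (g * x (suc i)) + + 1 * (x (suc i) * r i)) (G-sym (suc i) zero)))
                      (∑-linear n (x zero) (+ 1) (λ i → G zero (suc i) * x (suc i)) (λ i → x (suc i) * r i))
      where
      expand : ∀ y g x₀ r → y * (g * x₀ + r) ≡ x₀ * (g * y) + + 1 * (y * r)
      expand = solve-∀

    condensed-row : ∀ i → (condense G ·ᵛ (x ∘ suc)) i ≡ G zero zero * r i + (- G (suc i) zero) * rowTail
    condensed-row i =
      trans (∑-cong n λ j → expand (G zero zero) (G (suc i) (suc j)) (G zero (suc j)) (G (suc i) zero) (x (suc j)))
            (∑-linear n (G zero zero) (- G (suc i) zero) (λ j → G′ i j * x (suc j)) (λ j → G zero (suc j) * x (suc j)))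
      where
      expand : ∀ g₀₀ gᵢⱼ g₀ⱼ gᵢ₀ y →
               (g₀₀ * gᵢⱼ - g₀ⱼ * gᵢ₀) * y ≡ g₀₀ * (gᵢⱼ * y) + (- gᵢ₀) * (g₀ⱼ * y)
      expand = solve-∀

    quadForm-condense : quadForm (condense G) (x ∘ suc) ≡ G zero zero * R + (- rowTail) * rowTail
    quadForm-condense =
      trans (∑-cong n λ i → trans (cong (x (suc i) *_) (condensed-row i))
                                  (trans (expand (x (suc i)) (G zero zero) (r i) (G (suc i) zero) rowTail)
                                         (cong (λ g → G zero zero * (x (suc i) * r i) + (- rowTail) * (g * x (suc i)))
                                               (G-sym (suc i) zero))))
            (∑-linear n (G zero zero) (- rowTail) (λ i → x (suc i) * r i) (λ i → G zero (suc i) * x (suc i)))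
      where
      expand : ∀ y g₀₀ t gᵢ₀ σ → y * (g₀₀ * t + (- gᵢ₀) * σ) ≡ g₀₀ * (y * t) + (- σ) * (gᵢ₀ * y)
      expand = solve-∀

  completing-the-square : G zero zero * quadForm G x ≡ leading * leading + quadForm (condense G) (x ∘ suc)
  completing-the-square = begin
    G zero zero * quadForm G x
      ≡⟨⟩
    G zero zero * (x zero * leading + ∑ n (λ i → x (suc i) * (G (suc i) zero * x zero + r i)))
      ≡⟨ cong (λ t → G zero zero * (x zero * leading + t)) tail-part ⟩
    G zero zero * (x zero * leading + (x zero * rowTail + + 1 * R))
      ≡⟨ square (G zero zero) (x zero) rowTail R ⟩
    leading * leading + (G zero zero * R + (- rowTail) * rowTail)
      ≡⟨ cong (λ t → leading * leading + t) quadForm-condense ⟨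
    leading * leading + quadForm (condense G) (x ∘ suc) ∎
    where
    open ≡-Reasoning
    square : ∀ g x₀ σ ρ →
             g * (x₀ * (g * x₀ + σ) + (x₀ * σ + + 1 * ρ)) ≡ (g * x₀ + σ) * (g * x₀ + σ) + (g * ρ + (- σ) * σ)
    square = solve-∀

record PositiveDefinite {n} (G : Matrix n) : Set where
  field
    nonNegative : ∀ x → + 0 ≤ quadForm G x
    definite    : ∀ x → quadForm G x ≡ + 0 → ∀ i → x i ≡ + 0
    bounded     : ∀ q → ∃ λ B → ∀ x → quadForm G x ≤ + q → ∀ i → ∣ x i ∣ ℕ.≤ B

linearForm-bounded : ∀ n (a : Fin n → ℤ) →
  ∃ λ C → ∀ B (y : Fin n → ℤ) → (∀ j → ∣ y j ∣ ℕ.≤ B) → ∣ ∑ n (λ j → a j * y j) ∣ ℕ.≤ C ℕ.* B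
linearForm-bounded zero    a = 0 , λ _ _ _ → ℕ.z≤n
linearForm-bounded (suc n) a with linearForm-bounded n (a ∘ suc)
... | C , bound = ∣ a zero ∣ ℕ.+ C , λ B y y≤B → begin
  ∣ a zero * y zero + ∑ n (λ j → a (suc j) * y (suc j)) ∣
    ≤⟨ ℤ.∣i+j∣≤∣i∣+∣j∣ (a zero * y zero) _ ⟩
  ∣ a zero * y zero ∣ ℕ.+ ∣ ∑ n (λ j → a (suc j) * y (suc j)) ∣
    ≤⟨ ℕ.+-mono-≤ (ℕ.≤-reflexive (ℤ.abs-* (a zero) (y zero))) (bound B (y ∘ suc) (y≤B ∘ suc)) ⟩
  ∣ a zero ∣ ℕ.* ∣ y zero ∣ ℕ.+ C ℕ.* B
    ≤⟨ ℕ.+-monoˡ-≤ (C ℕ.* B) (ℕ.*-monoʳ-≤ ∣ a zero ∣ (y≤B zero)) ⟩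
  ∣ a zero ∣ ℕ.* B ℕ.+ C ℕ.* B
    ≡⟨ ℕ.*-distribʳ-+ B ∣ a zero ∣ C ⟨
  (∣ a zero ∣ ℕ.+ C) ℕ.* B ∎
  where open ℕ.≤-Reasoning

module PositiveDefiniteStep {n} (G : Matrix (suc n)) (G-sym : IsSymmetric G)
                            (pivot>0 : + 0 < G zero zero) (condense-pd : PositiveDefinite (condense G)) where
  open PositiveDefinite condense-pd using () renaming (nonNegative to nonNegative′; definite to definite′; bounded to bounded′)
  open CompletingTheSquare G G-sym

  nonNegative : ∀ x → + 0 ≤ quadForm G x
  nonNegative x = nonNegative-*-cancelˡ (G zero zero) _ pivot>0
    (subst (+ 0 ≤_) (sym (completing-the-square x)) (ℤ.+-mono-≤ (square-nonNegative (leading x)) (nonNegative′ (x ∘ suc))))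

  definite : ∀ x → quadForm G x ≡ + 0 → ∀ i → x i ≡ + 0
  definite x Q≡0 = λ where
      zero    → positive-*≡0 (G zero zero) (x zero) pivot>0 (begin
        G zero zero * x zero              ≡⟨ ℤ.+-identityʳ _ ⟨
        G zero zero * x zero + + 0        ≡⟨ cong (λ t → G zero zero * x zero + t) rowTail≡0 ⟨
        leading x                         ≡⟨ square≡0⇒≡0 (leading x) (proj₁ parts) ⟩
        + 0                               ∎)
      (suc i) → tail≡0 i
    where
    parts : leading x * leading x ≡ + 0 × quadForm (condense G) (x ∘ suc) ≡ + 0
    parts = nonNegative-+≡0 (square-nonNegative (leading x)) (nonNegative′ (x ∘ suc))
              (trans (sym (completing-the-square x)) (trans (cong (G zero zero *_) Q≡0) (ℤ.*-zeroʳ (G zero zero))))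
    open ≡-Reasoning
    tail≡0 : ∀ i → x (suc i) ≡ + 0
    tail≡0 = definite′ (x ∘ suc) (proj₂ parts)
    rowTail≡0 : rowTail x ≡ + 0
    rowTail≡0 = ∑-zero n λ j → trans (cong (G zero (suc j) *_) (tail≡0 j)) (ℤ.*-zeroʳ (G zero (suc j)))

  bounded : ∀ q → ∃ λ B → ∀ x → quadForm G x ≤ + q → ∀ i → ∣ x i ∣ ℕ.≤ B
  bounded q with bounded′ (∣ G zero zero ∣ ℕ.* q) | linearForm-bounded n (λ j → G zero (suc j))
  ... | B′ , tail-bound | C , rowTail-bound = B′ ℕ.⊔ (gq ℕ.+ C ℕ.* B′) , λ x Q≤q → λ where
      zero    → ℕ.≤-trans (head-bound x Q≤q) (ℕ.m≤n⊔m B′ _)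
      (suc i) → ℕ.≤-trans (tail-bound (x ∘ suc) (condensed≤ x Q≤q) i) (ℕ.m≤m⊔n B′ _)
    where
    gq : ℕ
    gq = ∣ G zero zero ∣ ℕ.* q
    split≤ : ∀ x → quadForm G x ≤ + q → leading x * leading x + quadForm (condense G) (x ∘ suc) ≤ + gq
    split≤ x Q≤q = subst (_≤ + gq) (completing-the-square x) (positive-*-≤ (G zero zero) q pivot>0 Q≤q)
    condensed≤ : ∀ x → quadForm G x ≤ + q → quadForm (condense G) (x ∘ suc) ≤ + gq
    condensed≤ x Q≤q = ℤ.≤-trans (subst (_≤ leading x * leading x + Q′) (ℤ.+-identityˡ Q′)
                                          (ℤ.+-monoˡ-≤ Q′ (square-nonNegative (leading x))))
                                 (split≤ x Q≤q)
      where
      Q′ : ℤ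
      Q′ = quadForm (condense G) (x ∘ suc)
    leading-bound : ∀ x → quadForm G x ≤ + q → ∣ leading x ∣ ℕ.≤ gq
    leading-bound x Q≤q = ℕ.≤-trans (n≤n*n ∣ leading x ∣) (ℤ.drop‿+≤+ (subst (_≤ + gq) (square≡+∣∣² (leading x))
      (ℤ.≤-trans (subst (_≤ leading x * leading x + quadForm (condense G) (x ∘ suc)) (ℤ.+-identityʳ (leading x * leading x))
                        (ℤ.+-monoʳ-≤ (leading x * leading x) (nonNegative′ (x ∘ suc))))
                 (split≤ x Q≤q))))
    head-bound : ∀ x → quadForm G x ≤ + q → ∣ x zero ∣ ℕ.≤ gq ℕ.+ C ℕ.* B′
    head-bound x Q≤q = begin
      ∣ x zero ∣                   ≤⟨ ∣x∣≤∣a*x∣ (G zero zero) (x zero) pivot>0 ⟩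
      ∣ G zero zero * x zero ∣     ≡⟨ cong ∣_∣ (a≡a+b-b (G zero zero * x zero) (rowTail x)) ⟩
      ∣ leading x - rowTail x ∣    ≤⟨ ℤ.∣i-j∣≤∣i∣+∣j∣ (leading x) (rowTail x) ⟩
      ∣ leading x ∣ ℕ.+ ∣ rowTail x ∣ ≤⟨ ℕ.+-mono-≤ (leading-bound x Q≤q)
                                         (rowTail-bound B′ (x ∘ suc) (tail-bound (x ∘ suc) (condensed≤ x Q≤q))) ⟩
      gq ℕ.+ C ℕ.* B′             ∎
      where
      open ℕ.≤-Reasoning
      a≡a+b-b : ∀ a b → a ≡ (a + b) - b
      a≡a+b-b = solve-∀

finiteType-pivot : ∀ {n} (G : Matrix (suc n)) → FiniteType G → + 0 < G zero zero
finiteType-pivot G ft = subst (+ 0 <_) (det₁ (G zero zero)) (ft 1 (λ _ → zero) λ { zero zero () })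
  where
  det₁ : ∀ x → + 1 * (x * + 1) + + 0 ≡ x
  det₁ = solve-∀

finiteType-condense : ∀ {n} (G : Matrix (suc n)) → FiniteType G → FiniteType (condense G)
finiteType-condense {n} G ft k f f-inc =
  det-condense-positive k (λ a b → G (g a) (g b)) (finiteType-pivot G ft) (ft (suc k) g g-inc)
  where
  g : Fin (suc k) → Fin (suc n)
  g zero    = zero
  g (suc a) = suc (f a)
  g-inc : StrictlyIncreasing g
  g-inc zero    (suc b) _           = ℕ.s≤s ℕ.z≤n
  g-inc (suc a) (suc b) (ℕ.s≤s a<b) = ℕ.s≤s (f-inc a b a<b)

finiteType⇒positiveDefinite : ∀ n (G : Matrix n) → IsSymmetric G → FiniteType G → PositiveDefinite G
finiteType⇒positiveDefinite zero    G _     _  = record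
  { nonNegative = λ _ → +≤+ ℕ.z≤n ; definite = λ _ _ () ; bounded = λ _ → 0 , λ _ _ () }
finiteType⇒positiveDefinite (suc n) G G-sym ft = record
  { nonNegative = Step.nonNegative ; definite = Step.definite ; bounded = Step.bounded }
  where
  module Step = PositiveDefiniteStep G G-sym (finiteType-pivot G ft)
    (finiteType⇒positiveDefinite n (condense G) (condense-symmetric G G-sym) (finiteType-condense G ft))

-- Symmetrisation

record Symmetrisation {r} (A : Matrix r) : Set where
  field
    weight          : Fin r → ℤ
    form            : Matrix r
    form-symmetric  : IsSymmetric form
    form-finiteType : FiniteType form
    form-row        : ∀ σ j → form σ j ≡ weight σ * A j σ

symmetrisation : ∀ {r} (A : Matrix r) → Symmetrisable A → FiniteType A → Symmetrisation A
symmetrisation {r} A (d , d>0 , dA-sym) A-ft = record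
  { weight = weight ; form = form ; form-symmetric = form-symmetric
  ; form-finiteType = form-finiteType ; form-row = form-row }
  where
  D : Fin r → ℤ
  D i = + d i
  D>0 : ∀ i → + 0 < D i
  D>0 i = +<+ (d>0 i)
  weight : Fin r → ℤ
  weight = ∏-except D
  form : Matrix r
  form i j = A i j * weight j
  form-row : ∀ σ j → form σ j ≡ weight σ * A j σ
  form-row σ j =
    *-cancelʳ-positive (A σ j * weight j) (weight σ * A j σ) (D σ * D j) (*-positive (D>0 σ) (D>0 j)) (begin
    (A σ j * weight j) * (D σ * D j)   ≡⟨ regroup (A σ j) (weight j) (D σ) (D j) ⟩
    (D σ * A σ j) * (D j * weight j)   ≡⟨ cong₂ _*_ (dA-sym σ j) (*-∏-except D j) ⟩
    (D j * A j σ) * ∏ D                ≡⟨ cong ((D j * A j σ) *_) (*-∏-except D σ) ⟨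
    (D j * A j σ) * (D σ * weight σ)   ≡⟨ regroup′ (A j σ) (weight σ) (D σ) (D j) ⟩
    (weight σ * A j σ) * (D σ * D j)   ∎)
    where
    open ≡-Reasoning
    regroup : ∀ a w x y → (a * w) * (x * y) ≡ (x * a) * (y * w)
    regroup = solve-∀
    regroup′ : ∀ a w x y → (y * a) * (x * w) ≡ (w * a) * (x * y)
    regroup′ = solve-∀
  form-symmetric : IsSymmetric form
  form-symmetric i j = trans (form-row i j) (ℤ.*-comm (weight i) (A j i))
  form-finiteType : FiniteType form
  form-finiteType k f f-inc = subst (+ 0 <_) (sym (det-scale-columns k (λ a b → A (f a) (f b)) (weight ∘ f)))
    (*-positive (∏-positive k (weight ∘ f) (∏-except-positive D D>0 ∘ f)) (A-ft k f f-inc))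

-- The Coxeter transformation

pairing : ∀ {r} → Matrix r → Fin r → (Fin r → ℤ) → ℤ
pairing {r} A σ y = ∑ r (λ j → A j σ * y j)

reflection : ∀ {r} → Matrix r → Fin r → (Fin r → ℤ) → Fin r → ℤ
reflection A σ y i = y i + δ σ i * (- pairing A σ y)

-- v arises from u by applying the reflections at 0, 1, …, r - 1 in turn;
-- mix (toℕ σ) u v is the intermediate vector to which the reflection at σ is applied.
IsCoxeterImage : ∀ {r} → Matrix r → (u v : Fin r → ℤ) → Set
IsCoxeterImage A u v = ∀ σ → pairing A σ (mix (toℕ σ) u v) ≡ u σ - v σ

module Invariance {r} {A : Matrix r} (A-diag : ∀ i → A i i ≡ + 2) (S : Symmetrisation A) where
  open Symmetrisation S

  form-·ᵛ : ∀ y σ → (form ·ᵛ y) σ ≡ weight σ * pairing A σ y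
  form-·ᵛ y σ = trans (∑-cong r λ j → trans (cong (_* y j) (form-row σ j)) (ℤ.*-assoc (weight σ) (A j σ) (y j)))
                      (∑-*ˡ r (weight σ) λ j → A j σ * y j)

  quadForm-reflection : ∀ y σ → quadForm form (reflection A σ y) ≡ quadForm form y
  quadForm-reflection y σ = begin
    quadForm form (reflection A σ y)
      ≡⟨ quadForm-shift r form form-symmetric y σ (- pairing A σ y) ⟩
    quadForm form y + (- pairing A σ y) * (+ 2 * (form ·ᵛ y) σ + (- pairing A σ y) * form σ σ)
      ≡⟨ cong₂ (λ g h → quadForm form y + (- pairing A σ y) * (+ 2 * g + (- pairing A σ y) * h))
               (form-·ᵛ y σ) (trans (form-row σ σ) (cong (weight σ *_) (A-diag σ))) ⟩
    quadForm form y + (- pairing A σ y) * (+ 2 * (weight σ * pairing A σ y) + (- pairing A σ y) * (weight σ * + 2))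
      ≡⟨ cancel (quadForm form y) (weight σ) (pairing A σ y) ⟩
    quadForm form y ∎
    where
    open ≡-Reasoning
    cancel : ∀ q w p → q + (- p) * (+ 2 * (w * p) + (- p) * (w * + 2)) ≡ q
    cancel = solve-∀

  quadForm-coxeterStep : ∀ {u v} → IsCoxeterImage A u v → ∀ σ s → toℕ σ ≡ s →
                         quadForm form (mix (suc s) u v) ≡ quadForm form (mix s u v)
  quadForm-coxeterStep {u} {v} cox σ s σ≡s =
    trans (quadForm-cong form reflected) (quadForm-reflection (mix s u v) σ)
    where
    pairing≡ : pairing A σ (mix s u v) ≡ u σ - v σ
    pairing≡ = subst (λ t → pairing A σ (mix t u v) ≡ u σ - v σ) σ≡s (cox σ)
    reflected : mix (suc s) u v ≗ reflection A σ (mix s u v)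
    reflected i with σ Fin.≟ i
    ... | yes refl rewrite pairing≡ | δ-diag σ
                         | mix-below {s = suc s} {u} {v} (ℕ.≤-reflexive (cong suc σ≡s))
                         | mix-above {s = s} {u} {v} (ℕ.<-irrefl σ≡s)
      = v≡u+[v-u] (u σ) (v σ)
      where
      v≡u+[v-u] : ∀ a b → b ≡ a + + 1 * (- (a - b))
      v≡u+[v-u] = solve-∀
    ... | no σ≢i rewrite δ-off (σ≢i ∘ sym) =
      trans (mix-suc {u = u} (λ i≡s → σ≢i (Fin.toℕ-injective (trans σ≡s (sym i≡s)))))
            (sym (trans (cong (λ t → mix s u v i + t) (ℤ.*-zeroˡ (- pairing A σ (mix s u v)))) (ℤ.+-identityʳ _)))

  quadForm-coxeterImage : ∀ {u v} → IsCoxeterImage A u v → quadForm form v ≡ quadForm form u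
  quadForm-coxeterImage {u} {v} cox = begin
    quadForm form v                ≡⟨ quadForm-cong form (mix-all u v) ⟨
    quadForm form (mix r u v)      ≡⟨ steps r ℕ.≤-refl ⟩
    quadForm form (mix 0 u v)      ≡⟨ quadForm-cong form (mix-zero u v) ⟩
    quadForm form u                ∎
    where
    open ≡-Reasoning
    steps : ∀ s → s ℕ.≤ r → quadForm form (mix s u v) ≡ quadForm form (mix 0 u v)
    steps zero    _   = refl
    steps (suc s) s<r = trans (quadForm-coxeterStep cox (Fin.fromℕ< s<r) s (Fin.toℕ-fromℕ< s<r)) (steps s (ℕ.<⇒≤ s<r))

  quadForm-coxeterFixed : ∀ {y} → IsCoxeterImage A y y → quadForm form y ≡ + 0
  quadForm-coxeterFixed {y} cox = ∑-zero r λ σ → begin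
    y σ * (form ·ᵛ y) σ                 ≡⟨ cong (y σ *_) (form-·ᵛ y σ) ⟩
    y σ * (weight σ * pairing A σ y)    ≡⟨ cong (λ p → y σ * (weight σ * p)) (fixed σ) ⟩
    y σ * (weight σ * + 0)              ≡⟨ cong (y σ *_) (ℤ.*-zeroʳ (weight σ)) ⟩
    y σ * + 0                           ≡⟨ ℤ.*-zeroʳ (y σ) ⟩
    + 0                                 ∎
    where
    open ≡-Reasoning
    fixed : ∀ σ → pairing A σ y ≡ + 0
    fixed σ = trans (∑-cong r λ j → cong (A j σ *_) (sym (mix-same (toℕ σ) y j)))
                    (trans (cox σ) (ℤ.+-inverseʳ (y σ)))

pairing-+ : ∀ {r} (A : Matrix r) σ (y z : Fin r → ℤ) → pairing A σ (λ j → y j + z j) ≡ pairing A σ y + pairing A σ z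
pairing-+ {r} A σ y z = trans (∑-cong r λ j → ℤ.*-distribˡ-+ (A j σ) (y j) (z j)) (∑-+ r _ _)

coxeterImage-zero : ∀ {r} (A : Matrix r) → IsCoxeterImage A (λ _ → + 0) (λ _ → + 0)
coxeterImage-zero {r} A σ = ∑-zero r λ j → trans (cong (A j σ *_) (mix-same (toℕ σ) (λ _ → + 0) j)) (ℤ.*-zeroʳ (A j σ))

coxeterImage-+ : ∀ {r} (A : Matrix r) {u v u′ v′} → IsCoxeterImage A u v → IsCoxeterImage A u′ v′ →
                 IsCoxeterImage A (λ i → u i + u′ i) (λ i → v i + v′ i)
coxeterImage-+ {r} A {u} {v} {u′} {v′} cox cox′ σ = begin
  pairing A σ (mix (toℕ σ) (λ i → u i + u′ i) (λ i → v i + v′ i))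
    ≡⟨ ∑-cong r (λ j → cong (A j σ *_) (mix-+ (toℕ σ) u u′ v v′ j)) ⟩
  pairing A σ (λ j → mix (toℕ σ) u v j + mix (toℕ σ) u′ v′ j)
    ≡⟨ pairing-+ A σ _ _ ⟩
  pairing A σ (mix (toℕ σ) u v) + pairing A σ (mix (toℕ σ) u′ v′)
    ≡⟨ cong₂ _+_ (cox σ) (cox′ σ) ⟩
  (u σ - v σ) + (u′ σ - v′ σ)
    ≡⟨ interchange (u σ) (v σ) (u′ σ) (v′ σ) ⟩
  (u σ + u′ σ) - (v σ + v′ σ) ∎
  where
  open ≡-Reasoning
  interchange : ∀ a b c d → (a - b) + (c - d) ≡ (a + c) - (b + d)
  interchange = solve-∀

coxeterImage-cong : ∀ {r} (A : Matrix r) {u v u′ v′} → u ≗ u′ → v ≗ v′ →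
                    IsCoxeterImage A u v → IsCoxeterImage A u′ v′
coxeterImage-cong {r} A {u} {v} {u′} {v′} u≗u′ v≗v′ cox σ =
  trans (∑-cong r λ j → cong (A j σ *_) (mix-cong j))
        (trans (cox σ) (cong₂ _-_ (u≗u′ σ) (v≗v′ σ)))
  where
  mix-cong : ∀ j → mix (toℕ σ) u′ v′ j ≡ mix (toℕ σ) u v j
  mix-cong j with toℕ j ℕ.<? toℕ σ
  ... | yes _ = sym (v≗v′ j)
  ... | no _  = sym (u≗u′ j)

coxeterImage-sumUpTo : ∀ {r} (A : Matrix r) L (x : ℕ → Fin r → ℤ) → (∀ t → IsCoxeterImage A (x t) (x (suc t))) →
                       IsCoxeterImage A (λ i → sumUpTo L (λ t → x t i)) (λ i → sumUpTo L (λ t → x (suc t) i))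
coxeterImage-sumUpTo A zero    x cox = coxeterImage-zero A
coxeterImage-sumUpTo A (suc L) x cox = coxeterImage-+ A (cox 0) (coxeterImage-sumUpTo A L (x ∘ ℕ.suc) (cox ∘ ℕ.suc))

bounded-sequence-repeats : ∀ {r} B (x : ℕ → Fin r → ℕ) → (∀ t i → x t i ℕ.≤ B) →
                           ∃₂ λ p q → p ℕ.< q × x p ≗ x q
bounded-sequence-repeats {r} B x x≤B = repeat (Fin.pigeonhole (ℕ.n<1+n (suc B ℕ.^ r)) (Fin.funToFin ∘ code ∘ toℕ))
  where
  open ≡-Reasoning
  code : ℕ → Fin r → Fin (suc B)
  code t i = Fin.fromℕ< (ℕ.s≤s (x≤B t i))
  decode : ∀ {f g : Fin r → Fin (suc B)} → Fin.funToFin f ≡ Fin.funToFin g → f ≗ g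
  decode {f} {g} eq i = trans (sym (Fin.finToFun-funToFin f i)) (trans (cong (λ c → Fin.finToFun c i) eq) (Fin.finToFun-funToFin g i))
  repeat : (∃₂ λ p q → p Fin.< q × Fin.funToFin (code (toℕ p)) ≡ Fin.funToFin (code (toℕ q))) →
           ∃₂ λ p q → p ℕ.< q × x p ≗ x q
  repeat (p , q , p<q , same-code) = toℕ p , toℕ q , p<q , λ i → begin
    x (toℕ p) i              ≡⟨ Fin.toℕ-fromℕ< _ ⟨
    toℕ (code (toℕ p) i)     ≡⟨ cong toℕ (decode same-code i) ⟩
    toℕ (code (toℕ q) i)     ≡⟨ Fin.toℕ-fromℕ< _ ⟩
    x (toℕ q) i              ∎

module CoxeterOrbit {r} {A : Matrix r} (A-diag : ∀ i → A i i ≡ + 2) (S : Symmetrisation A)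
                    (x : ℕ → Fin r → ℕ) (cox : ∀ t → IsCoxeterImage A (λ i → + x t i) (λ i → + x (suc t) i)) where
  open Symmetrisation S
  open Invariance A-diag S
  open PositiveDefinite (finiteType⇒positiveDefinite r form form-symmetric form-finiteType)

  X : ℕ → Fin r → ℤ
  X t i = + x t i

  quadForm-orbit : ∀ t → quadForm form (X t) ≡ quadForm form (X 0)
  quadForm-orbit zero    = refl
  quadForm-orbit (suc t) = trans (quadForm-coxeterImage (cox t)) (quadForm-orbit t)

  orbit-bounded : ∃ λ B → ∀ t i → x t i ℕ.≤ B
  orbit-bounded with bounded ∣ quadForm form (X 0) ∣
  ... | B , bound = B , λ t → bound (X t) (ℤ.≤-reflexive
                      (trans (quadForm-orbit t) (sym (ℤ.0≤i⇒+∣i∣≡i (nonNegative (X 0))))))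

  quadForm-zero : quadForm form (λ _ → + 0) ≡ + 0
  quadForm-zero = ∑-zero r λ i → ℤ.*-zeroˡ ((form ·ᵛ (λ _ → + 0)) i)

  orbit-vanishes-at-return : ∀ p L → x p ≗ x (p ℕ.+ suc L) → ∀ i → x p i ≡ 0
  orbit-vanishes-at-return p L return i = ℤ.+-injective (begin
    X p i        ≡⟨ cong (λ t → X t i) (ℕ.+-identityʳ p) ⟨
    period 0 i   ≡⟨ proj₁ (nonNegative-+≡0 (+≤+ ℕ.z≤n) (sumUpTo-nonNegative L _ (λ _ → +≤+ ℕ.z≤n))
                                           (total≡0 i)) ⟩
    + 0          ∎)
    where
    open ≡-Reasoning
    period : ℕ → Fin r → ℤ
    period t = X (p ℕ.+ t)
    total : Fin r → ℤ
    total i = sumUpTo (suc L) (λ t → period t i)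
    shifted≗total : (λ i → sumUpTo (suc L) (λ t → period (suc t) i)) ≗ total
    shifted≗total i = +-cancelʳ (period 0 i) _ _ (trans (sumUpTo-shift (suc L) (λ t → period t i))
      (cong (λ z → total i + z) (sym (cong +_ (trans (cong (λ t → x t i) (ℕ.+-identityʳ p)) (return i))))))
    total-fixed : IsCoxeterImage A total total
    total-fixed = coxeterImage-cong A (λ _ → refl) shifted≗total
      (coxeterImage-sumUpTo A (suc L) period λ t →
         coxeterImage-cong A (λ _ → refl) (λ i → cong (λ s → X s i) (sym (ℕ.+-suc p t))) (cox (p ℕ.+ t)))
    total≡0 : ∀ i → total i ≡ + 0
    total≡0 = definite total (quadForm-coxeterFixed total-fixed)

  orbit-start-vanishes : ∀ i → x 0 i ≡ 0
  orbit-start-vanishes with orbit-bounded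
  ... | B , x≤B with bounded-sequence-repeats B x x≤B
  ... | p , q , p<q , xp≗xq with ℕ.m≤n⇒∃[o]m+o≡n p<q
  ... | L , refl = λ i → ℤ.+-injective (definite (X 0) (begin
    quadForm form (X 0)               ≡⟨ quadForm-orbit p ⟨
    quadForm form (X p)               ≡⟨ quadForm-cong form (λ i → cong +_ (orbit-vanishes-at-return p L return i)) ⟩
    quadForm form (λ _ → + 0)         ≡⟨ quadForm-zero ⟩
    + 0                               ∎) i)
    where
    open ≡-Reasoning
    return : x p ≗ x (p ℕ.+ suc L)
    return j = trans (xp≗xq j) (cong (λ t → x t j) (sym (ℕ.+-suc p L)))

-- Tropical friezes

when< : ∀ {r} → Fin r → Fin r → ℤ → ℤ
when< a b x with toℕ a ℕ.<? toℕ b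
... | yes _ = x
... | no _  = + 0

module _ {r} {a b : Fin r} {x : ℤ} where

  when<-yes : toℕ a ℕ.< toℕ b → when< a b x ≡ x
  when<-yes a<b with toℕ a ℕ.<? toℕ b
  ... | yes _  = refl
  ... | no a≮b = ⊥-elim (a≮b a<b)

  when<-no : ¬ toℕ a ℕ.< toℕ b → when< a b x ≡ + 0
  when<-no a≮b with toℕ a ℕ.<? toℕ b
  ... | yes a<b = ⊥-elim (a≮b a<b)
  ... | no _    = refl

linearFrieze⇒coxeterImage : ∀ {r} (A : Matrix r) → (∀ i → A i i ≡ + 2) → ∀ {u v : Fin r → ℤ} →
  (∀ i → u i + v i ≡ ∑ r (λ j → when< i j ((- A j i) * u j)) + ∑ r (λ j → when< j i ((- A j i) * v j))) →
  IsCoxeterImage A u v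
linearFrieze⇒coxeterImage {r} A A-diag {u} {v} rel σ = begin
  pairing A σ (mix (toℕ σ) u v)
    ≡⟨ ∑-cong r term ⟩
  ∑ r (λ j → δ σ j * (+ 2 * u σ) + - (above j + below j))
    ≡⟨ trans (∑-+ r _ _) (cong₂ _+_ (∑-δ r σ (λ _ → + 2 * u σ)) (trans (∑-neg r _) (cong -_ (∑-+ r above below)))) ⟩
  + 2 * u σ + - (∑ r above + ∑ r below)
    ≡⟨ cong (λ t → + 2 * u σ + - t) (rel σ) ⟨
  + 2 * u σ + - (u σ + v σ)
    ≡⟨ simplify (u σ) (v σ) ⟩
  u σ - v σ ∎
  where
  open ≡-Reasoning
  above below : Fin r → ℤ
  above j = when< σ j ((- A j σ) * u j)
  below j = when< j σ ((- A j σ) * v j)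
  simplify : ∀ a b → + 2 * a + - (a + b) ≡ a - b
  simplify = solve-∀
  term : ∀ j → A j σ * mix (toℕ σ) u v j ≡ δ σ j * (+ 2 * u σ) + - (above j + below j)
  term j with ℕ.<-cmp (toℕ j) (toℕ σ)
  ... | tri< j<σ j≢σ _ rewrite mix-below {s = toℕ σ} {u} {v} j<σ | δ-off {σ = σ} (j≢σ ∘ cong toℕ)
                             | when<-no {a = σ} {j} {(- A j σ) * u j} (ℕ.<⇒≯ j<σ)
                             | when<-yes {a = j} {σ} {(- A j σ) * v j} j<σ
    = lower (A j σ) (v j) (+ 2 * u σ)
    where
    lower : ∀ a y c → a * y ≡ + 0 * c + - (+ 0 + (- a) * y)
    lower = solve-∀
  ... | tri> _ j≢σ σ<j rewrite mix-above {s = toℕ σ} {u} {v} (ℕ.<⇒≯ σ<j) | δ-off {σ = σ} (j≢σ ∘ cong toℕ)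
                             | when<-yes {a = σ} {j} {(- A j σ) * u j} σ<j
                             | when<-no {a = j} {σ} {(- A j σ) * v j} (ℕ.<⇒≯ σ<j)
    = upper (A j σ) (u j) (+ 2 * u σ)
    where
    upper : ∀ a y c → a * y ≡ + 0 * c + - ((- a) * y + + 0)
    upper = solve-∀
  ... | tri≈ _ j≡σ _ with Fin.toℕ-injective j≡σ
  ... | refl rewrite mix-above {s = toℕ j} {u} {v} (ℕ.<-irrefl refl) | δ-diag j | A-diag j
                   | when<-no {a = j} {j} {(- + 2) * u j} (ℕ.<-irrefl refl) | when<-no {a = j} {j} {(- + 2) * v j} (ℕ.<-irrefl refl)
    = diagonal (u j)
    where
    diagonal : ∀ y → + 2 * y ≡ + 1 * (+ 2 * y) + - (+ 0 + + 0)
    diagonal = solve-∀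

-- IsTropicalYFrieze is phrased with a helper local to Defs, which cannot be named here; the
-- left-hand sides of upper-agrees and lower-agrees are therefore left to unification.
mutual
  tropicalFrieze⇒linear : ∀ {r} (A : Matrix r) (k : Fin r → ℤ → ℕ) → IsTropicalYFrieze A k → ∀ m i →
    + k i m + + k i (m + + 1) ≡
      ∑ r (λ j → when< i j ((- A j i) * + k j m)) + ∑ r (λ j → when< j i ((- A j i) * + k j (m + + 1)))
  tropicalFrieze⇒linear {r} A k frieze m i =
    trans (frieze i m) (cong₂ _+_ (∑-cong r (upper-agrees A k i m)) (∑-cong r (lower-agrees A k i m)))

  upper-agrees : ∀ {r} (A : Matrix r) (k : Fin r → ℤ → ℕ) i m j → _ ≡ when< i j ((- A j i) * + k j m)
  upper-agrees A k i m j with toℕ i ℕ.<? toℕ j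
  ... | yes _ = refl
  ... | no _  = refl

  lower-agrees : ∀ {r} (A : Matrix r) (k : Fin r → ℤ → ℕ) i m j → _ ≡ when< j i ((- A j i) * + k j (m + + 1))
  lower-agrees A k i m j with toℕ j ℕ.<? toℕ i
  ... | yes _ = refl
  ... | no _  = refl

proposition5p3 : (r : ℕ) (A : Matrix r) → IsCartan A → FiniteType A → Indecomposable A →
    (k : Fin r → ℤ → ℕ) → IsTropicalYFrieze A k →
      ∀ i m → k i m ≡ 0
proposition5p3 r A cartan finite _ k frieze i m =
  subst (λ m′ → k i m′ ≡ 0) (ℤ.+-identityʳ m)
    (CoxeterOrbit.orbit-start-vanishes diag (symmetrisation A symmetrisable finite) (λ t j → k j (m + + t)) step i)
  where
  open IsCartan cartan
  step : ∀ t → IsCoxeterImage A (λ j → + k j (m + + t)) (λ j → + k j (m + + suc t))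
  step t = coxeterImage-cong A (λ _ → refl) (λ j → cong (λ m′ → + k j m′) next)
             (linearFrieze⇒coxeterImage A diag (tropicalFrieze⇒linear A k frieze (m + + t)))
    where
    next : (m + + t) + + 1 ≡ m + + suc t
    next = trans (ℤ.+-assoc m (+ t) (+ 1)) (cong (λ n → m + + n) (ℕ.+-comm t 1))
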